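{- Let $\Gamma$ be the directed graph whose vertices are the pairs $(n,k)$ with integers $n\ge k\ge 0$, and whose edges are, for every $n\ge k\ge 0$, an edge from $(n+1,k)$ to $(n+1,k+1)$ and an edge from $(n,n-k)$ to $(n+1,k+1)$. For $0\le i\le n$, $0\le k\le n$, let $\pi(n,k,i)$ be the number of directed paths in $\Gamma$ from vertex $(i,0)$ to vertex $(n,k)$. Let the Entringer numbers $E_{n,k}$ ($n\ge k\ge0$) be defined by $E_{0,0}=1$, $E_{n,0}=0$ for $n\ge1$, and $E_{n+1,k+1}=E_{n+1,k}+E_{n,n-k}$ for $n\ge k\ge0$, and let $E_m$ be the number of down-up permutations of $\{1,\ldots,m\}$ (with $E_0=1$). Then for $n\ge1$ and $0\le k\le n-1$, $$\pi(n,k,0)=E_{n,k}=\sum_{r=0}^{\lfloor (k-1)/2\rfloor}(-1)^r\binom{k}{2r+1}E_{n-2r-1}.$$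
   Context: A permutation $(p_1,\ldots,p_m)$ of $\{1,\ldots,m\}$ is down-up if $p_1>p_2<p_3>p_4<\cdots$. The number $E_{n,k}$ equals the number of down-up permutations of $\{1,\ldots,n+1\}$ beginning with $k+1$. An empty sum (when $\lfloor (k-1)/2\rfloor<0$) is $0$. -}

module Defs where

open import Data.Nat using (ℕ; zero; suc; _+_; _*_; _∸_; _≤_; _<_; _<?_)
open import Data.Nat.Combinatorics using (_C_)
open import Data.Integer as ℤ using (ℤ; +_; -_; 0ℤ; 1ℤ)
open import Data.Product using (_×_; _,_)
open import Data.Unit using (⊤)
open import Data.List using (List; []; _∷_; map; concatMap; filter; length; applyUpTo; upTo; foldr)
open import Relation.Nullary using (Dec; yes; _×-dec_)
open import Data.Unit using (tt)
import Data.Nat.Properties as ℕₚ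
open import Data.List.Relation.Unary.Unique.DecPropositional ℕₚ._≟_ using (Unique; unique?)

-- Vertices are pairs (n , k) with n ≥ k ≥ 0
-- (every edge below only connects such pairs).

Vertex : Set
Vertex = ℕ × ℕ

data Edge : Vertex → Vertex → Set where
  horiz : ∀ {n k} → k ≤ n → Edge (suc n , k) (suc n , suc k)
  diag  : ∀ {n k} → k ≤ n → Edge (n , n ∸ k) (suc n , suc k)

-- Directed paths (Γ is acyclic, so walks are paths) from s to t.
data Path (s : Vertex) : Vertex → Set where
  here : Path s s
  step : ∀ {u t} → Path s u → Edge u t → Path s t

-- Entringer numbers: E 0 0 = 1, E (n+1) 0 = 0,
-- E (n+1) (k+1) = E (n+1) k + E n (n - k)   (relevant for k ≤ n;
-- values with k > n are junk and never used).

E : ℕ → ℕ → ℕ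
E zero    zero    = 1
E zero    (suc k) = 0
E (suc n) zero    = 0
E (suc n) (suc k) = E (suc n) k + E n (n ∸ k)

Down Up : List ℕ → Set
Down []           = ⊤
Down (x ∷ [])     = ⊤
Down (x ∷ y ∷ l)  = (y < x) × Up (y ∷ l)
Up []             = ⊤
Up (x ∷ [])       = ⊤
Up (x ∷ y ∷ l)    = (x < y) × Down (y ∷ l)

down? : (l : List ℕ) → Dec (Down l)
up?   : (l : List ℕ) → Dec (Up l)
down? []          = yes tt
down? (x ∷ [])    = yes tt
down? (x ∷ y ∷ l) = (y <? x) ×-dec up? (y ∷ l)
up? []            = yes tt
up? (x ∷ [])      = yes tt
up? (x ∷ y ∷ l)   = (x <? y) ×-dec down? (y ∷ l)

words : List ℕ → ℕ → List (List ℕ)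
words xs zero    = [] ∷ []
words xs (suc n) = concatMap (λ x → map (x ∷_) (words xs n)) xs

-- Permutations of {1,…,m} = words of length m over {1,…,m} without
-- repeated letters.  Eₘ = number of down-up permutations of {1,…,m}.
downUpCount : ℕ → ℕ
downUpCount m =
  length (filter (λ l → unique? l ×-dec down? l) (words (applyUpTo suc m) m))

-- The index set {0,…,⌊(k-1)/2⌋} is {r : 2r+1 ≤ k}, i.e. r < ⌊(k+1)/2⌋;
-- we sum over r ∈ upTo k filtered by 2r+1 ≤ k (empty when k = 0).

sumℤ : List ℤ → ℤ
sumℤ = foldr ℤ._+_ 0ℤ

altTerm : ℕ → ℕ → ℕ → ℤ
altTerm n k r = ((- 1ℤ) ℤ.^ r) ℤ.* (+ ((k C (2 * r + 1)) * downUpCount (n ∸ (2 * r + 1))))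

altSum : ℕ → ℕ → ℤ
altSum n k = sumℤ (map (altTerm n k) (filter (λ r → (2 * r + 1) Data.Nat.≤? k) (upTo k)))

{-# OPTIONS --safe #-}
-- Deleting the last edge of a path into (n+1,k+1) leaves a path into (n+1,k) or into
-- (n,n-k): this is the Entringer recurrence, so the paths from (0,0) are counted by E.
--
-- Sorting the permutations of {1,…,m+1} by their first letter i+1, and relabelling the
-- other letters order-preservingly onto {1,…,m}, gives recurrences for the numbers of
-- permutations w of {1,…,m} with y > w₁ < w₂ > ⋯ and with y < w₁ > w₂ < ⋯. Reversing the
-- order of summation shows that y ↦ m+1-y exchanges the two counts, and then that the
-- first one, at y = k+1, satisfies the Entringer recurrence; in particular E_m = E m m.
--
-- Finally Pascal's rule shows that the odd and even alternating binomial sums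
--   F(n,k) = Σ (-1)^r C(k,2r+1) E_{n-2r-1},   G(n,k) = Σ (-1)^r C(k,2r) E_{n-2r}
-- satisfy F(n+1,k+1) = F(n+1,k) + G(n,k) and G(n+1,k+1) + F(n,k) = G(n+1,k), which are the
-- recurrences of E n k and E n (n-k); the base cases are F(n+1,0) = 0 and G(n,0) = E_n.
module Submission where

open import Defs
open import Algebra.Bundles using (CommutativeMonoid)
open import Data.Empty using (⊥)
open import Data.Fin using (Fin)
open import Data.Fin.Properties using (0↔⊥; 1↔⊤; +↔⊎)
open import Data.Integer as ℤ using (ℤ; +_; -_; 0ℤ; 1ℤ)
import Data.Integer.Properties as ℤₚ
open import Data.List using (List; []; _∷_; _++_; map; filter; length; foldr; applyUpTo; upTo; concatMap)
open import Data.List.Properties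
  using (filter-≐; filter-accept; filter-reject; filter-++; filter-all; filter-none;
         length-++; length-map; map-∘; map-applyUpTo; map-concatMap; concatMap-map; concatMap-cong)
open import Data.List.Relation.Unary.All as All using (_∷_; all?)
open import Data.List.Relation.Unary.All.Properties using (applyUpTo⁺₂)
open import Data.List.Relation.Unary.AllPairs using (_∷_)
import Data.List.Relation.Unary.Unique.Propositional.Properties as Unique
open import Data.Nat as ℕ using (ℕ; zero; suc; _∸_; _≤_; _<_; z≤n; s≤s; s≤s⁻¹; _≟_)
import Data.Nat.Properties as ℕₚ
open import Data.List.Relation.Unary.Unique.DecPropositional _≟_ using (unique?)
open import Data.Nat.Combinatorics using (_C_; k>n⇒nCk≡0; nCk+nC[k+1]≡[n+1]C[k+1])
open import Data.Product using (_×_; _,_; proj₂)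
open import Data.Product.Function.NonDependent.Propositional using (_×-⇔_)
open import Data.Sum using (_⊎_; inj₁; inj₂)
open import Data.Sum.Function.Propositional using (_⊎-↔_)
open import Data.Unit using (⊤)
open import Function using (_∘_; id; _⇔_; mk⇔; _↔_; mk↔ₛ′; Equivalence)
open import Function.Properties.Equivalence using () renaming (refl to ⇔-refl)
open import Function.Properties.Inverse using (↔-trans; ↔-sym)
open import Relation.Nullary using (¬_; yes; no; _×-dec_; ¬?)
open import Relation.Unary using (Decidable)
open import Relation.Binary.PropositionalEquality
  using (_≡_; refl; sym; trans; cong; cong₂; module ≡-Reasoning)

open Equivalence using (to; from)

private variable
  A B : Set

module _ {i : ℕ} where

  split-last-edge : ∀ {n k} → Path (i , 0) (suc n , suc k) →
                    Path (i , 0) (suc n , k) ⊎ Path (i , 0) (n , n ∸ k)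
  split-last-edge (step p (horiz _)) = inj₁ p
  split-last-edge (step p (diag _))  = inj₂ p

  append-last-edge : ∀ {n k} → k ≤ n → Path (i , 0) (suc n , k) ⊎ Path (i , 0) (n , n ∸ k) →
                     Path (i , 0) (suc n , suc k)
  append-last-edge k≤n (inj₁ p) = step p (horiz k≤n)
  append-last-edge k≤n (inj₂ p) = step p (diag k≤n)

  Path-last-edge-↔ : ∀ {n k} → k ≤ n →
    Path (i , 0) (suc n , suc k) ↔ (Path (i , 0) (suc n , k) ⊎ Path (i , 0) (n , n ∸ k))
  Path-last-edge-↔ k≤n = mk↔ₛ′ split-last-edge (append-last-edge k≤n) split∘append append∘split
    where
    split∘append : ∀ q → split-last-edge (append-last-edge k≤n q) ≡ q
    split∘append (inj₁ _) = refl
    split∘append (inj₂ _) = refl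
    append∘split : ∀ p → append-last-edge k≤n (split-last-edge p) ≡ p
    append∘split (step p (horiz k≤n′)) = cong (λ k≤n → step p (horiz k≤n)) (ℕₚ.≤-irrelevant k≤n k≤n′)
    append∘split (step p (diag k≤n′))  = cong (λ k≤n → step p (diag k≤n)) (ℕₚ.≤-irrelevant k≤n k≤n′)

Path-origin-↔ : Path (0 , 0) (0 , 0) ↔ ⊤
Path-origin-↔ = mk↔ₛ′ _ (λ _ → here) (λ _ → refl) (λ { here → refl ; (step _ ()) })

Path-column-zero-↔ : ∀ {n} → Path (0 , 0) (suc n , 0) ↔ ⊥
Path-column-zero-↔ = mk↔ₛ′ (λ { (step _ ()) }) (λ ()) (λ ()) (λ { (step _ ()) })

paths↔E : ∀ n k → k ≤ n → Path (0 , 0) (n , k) ↔ Fin (E n k)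
paths↔E zero    zero    _         = ↔-trans Path-origin-↔ (↔-sym 1↔⊤)
paths↔E (suc n) zero    _         = ↔-trans Path-column-zero-↔ (↔-sym 0↔⊥)
paths↔E (suc n) (suc k) (s≤s k≤n) =
  ↔-trans (Path-last-edge-↔ k≤n)
    (↔-trans (paths↔E (suc n) k (ℕₚ.m≤n⇒m≤1+n k≤n) ⊎-↔ paths↔E n (n ∸ k) (ℕₚ.m∸n≤m n k))
             (↔-sym +↔⊎))

module Sum {c ℓ} (M : CommutativeMonoid c ℓ) where

  open import Data.Nat using (_+_)
  open CommutativeMonoid M hiding (refl; sym; trans)
  open CommutativeMonoid M using () renaming (refl to ≈-refl; sym to ≈-sym; trans to ≈-trans)
  open import Algebra.Properties.CommutativeSemigroup commutativeSemigroup using (interchange)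
  open import Relation.Binary.Reasoning.Setoid setoid

  ∑ : ℕ → (ℕ → Carrier) → Carrier
  ∑ zero    f = ε
  ∑ (suc n) f = f 0 ∙ ∑ n (f ∘ suc)

  ∑-cong : ∀ n {f g} → (∀ {t} → t < n → f t ≈ g t) → ∑ n f ≈ ∑ n g
  ∑-cong zero    _   = ≈-refl
  ∑-cong (suc n) f≈g = ∙-cong (f≈g (s≤s z≤n)) (∑-cong n (f≈g ∘ s≤s))

  ∑-zero : ∀ n {f} → (∀ {t} → t < n → f t ≈ ε) → ∑ n f ≈ ε
  ∑-zero zero    _   = ≈-refl
  ∑-zero (suc n) f≈ε = ≈-trans (∙-cong (f≈ε (s≤s z≤n)) (∑-zero n (f≈ε ∘ s≤s))) (identityˡ ε)

  ∑-+ : ∀ m n f → ∑ (m + n) f ≈ ∑ m f ∙ ∑ n (λ t → f (m + t))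
  ∑-+ zero    n f = ≈-sym (identityˡ _)
  ∑-+ (suc m) n f = ≈-trans (∙-congˡ (∑-+ m n (f ∘ suc))) (≈-sym (assoc _ _ _))

  ∑-distrib : ∀ n f g → ∑ n (λ t → f t ∙ g t) ≈ ∑ n f ∙ ∑ n g
  ∑-distrib zero    f g = ≈-sym (identityˡ ε)
  ∑-distrib (suc n) f g = ≈-trans (∙-congˡ (∑-distrib n (f ∘ suc) (g ∘ suc))) (interchange _ _ _ _)

  ∑-init-last : ∀ n f → ∑ (suc n) f ≈ ∑ n f ∙ f n
  ∑-init-last zero    f = ≈-trans (identityʳ _) (≈-sym (identityˡ _))
  ∑-init-last (suc n) f = ≈-trans (∙-congˡ (∑-init-last n (f ∘ suc))) (≈-sym (assoc _ _ _))

  ∑-drop-last : ∀ n f → f n ≈ ε → ∑ (suc n) f ≈ ∑ n f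
  ∑-drop-last n f fn≈ε = ≈-trans (∑-init-last n f) (≈-trans (∙-congˡ fn≈ε) (identityʳ _))

  ∑-reverse : ∀ n f → ∑ n f ≈ ∑ n (λ t → f (n ∸ suc t))
  ∑-reverse zero    f = ≈-refl
  ∑-reverse (suc n) f = begin
    ∑ (suc n) f                        ≈⟨ ∑-init-last n f ⟩
    ∑ n f ∙ f n                        ≈⟨ comm _ _ ⟩
    f n ∙ ∑ n f                        ≈⟨ ∙-congˡ (∑-reverse n f) ⟩
    f n ∙ ∑ n (λ t → f (n ∸ suc t))    ∎

  ∑-prefix : ∀ {k n} f → k ≤ n → (∀ {t} → k ≤ t → f t ≈ ε) → ∑ n f ≈ ∑ k f
  ∑-prefix {k} {n} f k≤n vanish = begin
    ∑ n f                                  ≡⟨ cong (λ m → ∑ m f) (sym (ℕₚ.m+[n∸m]≡n k≤n)) ⟩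
    ∑ (k + (n ∸ k)) f                      ≈⟨ ∑-+ k (n ∸ k) f ⟩
    ∑ k f ∙ ∑ (n ∸ k) (λ t → f (k + t))    ≈⟨ ∙-congˡ (∑-zero (n ∸ k) (λ _ → vanish (ℕₚ.m≤m+n k _))) ⟩
    ∑ k f ∙ ε                              ≈⟨ identityʳ _ ⟩
    ∑ k f                                  ∎

  ∑-suffix : ∀ {k n} f → k ≤ n → (∀ {t} → t < k → f t ≈ ε) → ∑ n f ≈ ∑ (n ∸ k) (λ t → f (k + t))
  ∑-suffix {k} {n} f k≤n vanish = begin
    ∑ n f                                  ≡⟨ cong (λ m → ∑ m f) (sym (ℕₚ.m+[n∸m]≡n k≤n)) ⟩
    ∑ (k + (n ∸ k)) f                      ≈⟨ ∑-+ k (n ∸ k) f ⟩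
    ∑ k f ∙ ∑ (n ∸ k) (λ t → f (k + t))    ≈⟨ ∙-congʳ (∑-zero k vanish) ⟩
    ε ∙ ∑ (n ∸ k) (λ t → f (k + t))        ≈⟨ identityˡ _ ⟩
    ∑ (n ∸ k) (λ t → f (k + t))            ∎

  foldr-map-applyUpTo : ∀ (f : A → Carrier) g n → foldr _∙_ ε (map f (applyUpTo g n)) ≈ ∑ n (f ∘ g)
  foldr-map-applyUpTo f g zero    = ≈-refl
  foldr-map-applyUpTo f g (suc n) = ∙-congˡ (foldr-map-applyUpTo f (g ∘ suc) n)

  foldr-map-filter : ∀ {P : A → Set} (P? : Decidable P) f → (∀ {x} → ¬ P x → f x ≈ ε) →
                     ∀ xs → foldr _∙_ ε (map f (filter P? xs)) ≈ foldr _∙_ ε (map f xs)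
  foldr-map-filter P? f vanish []       = ≈-refl
  foldr-map-filter P? f vanish (x ∷ xs) with P? x
  ... | yes _  = ∙-congˡ (foldr-map-filter P? f vanish xs)
  ... | no ¬px = ≈-trans (foldr-map-filter P? f vanish xs)
                       (≈-sym (≈-trans (∙-congʳ (vanish ¬px)) (identityˡ _)))

filter-map : ∀ {P : B → Set} (P? : Decidable P) (f : A → B) xs →
             filter P? (map f xs) ≡ map f (filter (P? ∘ f) xs)
filter-map P? f []       = refl
filter-map P? f (x ∷ xs) with P? (f x)
... | yes _ = cong (f x ∷_) (filter-map P? f xs)
... | no  _ = filter-map P? f xs

length-filter-map : ∀ {P : B → Set} (P? : Decidable P) (f : A → B) xs →
                    length (filter P? (map f xs)) ≡ length (filter (P? ∘ f) xs)
length-filter-map P? f xs = trans (cong length (filter-map P? f xs)) (length-map f (filter (P? ∘ f) xs))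

filter-×-dec : ∀ {P Q : A → Set} (P? : Decidable P) (Q? : Decidable Q) xs →
               filter (λ x → P? x ×-dec Q? x) xs ≡ filter Q? (filter P? xs)
filter-×-dec P? Q? []       = refl
filter-×-dec P? Q? (x ∷ xs) with P? x | Q? x
... | yes _ | yes qx = trans (cong (x ∷_) (filter-×-dec P? Q? xs)) (sym (filter-accept Q? qx))
... | yes _ | no ¬qx = trans (filter-×-dec P? Q? xs) (sym (filter-reject Q? ¬qx))
... | no  _ | _      = filter-×-dec P? Q? xs

length-filter-words-suc : ∀ {P : List ℕ → Set} (P? : Decidable P) xs n →
  length (filter P? (words xs (suc n))) ≡
  foldr ℕ._+_ 0 (map (λ x → length (filter (P? ∘ (x ∷_)) (words xs n))) xs)
length-filter-words-suc P? xs n = go xs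
  where
  W = words xs n
  go : ∀ ys → length (filter P? (concatMap (λ x → map (x ∷_) W) ys)) ≡
              foldr ℕ._+_ 0 (map (λ x → length (filter (P? ∘ (x ∷_)) W)) ys)
  go []       = refl
  go (y ∷ ys) = begin
    length (filter P? (map (y ∷_) W ++ rest))                ≡⟨ cong length (filter-++ P? (map (y ∷_) W) rest) ⟩
    length (filter P? (map (y ∷_) W) ++ filter P? rest)      ≡⟨ length-++ (filter P? (map (y ∷_) W)) ⟩
    length (filter P? (map (y ∷_) W)) ℕ.+ length (filter P? rest)
      ≡⟨ cong₂ ℕ._+_ (length-filter-map P? (y ∷_) W) (go ys) ⟩
    _ ∎
    where
    open ≡-Reasoning
    rest = concatMap (λ x → map (x ∷_) W) ys

words-map : ∀ (f : ℕ → ℕ) xs n → words (map f xs) n ≡ map (map f) (words xs n)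
words-map f xs zero    = refl
words-map f xs (suc n) = begin
  concatMap (λ y → map (y ∷_) (words (map f xs) n)) (map f xs)
    ≡⟨ cong (λ V → concatMap (λ y → map (y ∷_) V) (map f xs)) (words-map f xs n) ⟩
  concatMap (λ y → map (y ∷_) (map (map f) W)) (map f xs)
    ≡⟨ concatMap-map (λ y → map (y ∷_) (map (map f) W)) f xs ⟩
  concatMap (λ x → map (f x ∷_) (map (map f) W)) xs
    ≡⟨ concatMap-cong (λ x → trans (sym (map-∘ W)) (map-∘ W)) xs ⟩
  concatMap (λ x → map (map f) (map (x ∷_) W)) xs
    ≡⟨ map-concatMap (map f) (λ x → map (x ∷_) W) xs ⟨
  map (map f) (concatMap (λ x → map (x ∷_) W) xs) ∎
  where
  open ≡-Reasoning
  W = words xs n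

filter-all?-words : ∀ {P : ℕ → Set} (P? : Decidable P) xs n →
                    filter (all? P?) (words xs n) ≡ words (filter P? xs) n
filter-all?-words P? xs zero    = refl
filter-all?-words {P} P? xs (suc n) =
  trans (go xs) (cong (λ V → concatMap (λ x → map (x ∷_) V) (filter P? xs)) (filter-all?-words P? xs n))
  where
  W = words xs n
  keep : ∀ {y} → P y → filter (all? P?) (map (y ∷_) W) ≡ map (y ∷_) (filter (all? P?) W)
  keep {y} py = trans (filter-map (all? P?) (y ∷_) W)
                      (cong (map (y ∷_)) (filter-≐ _ (all? P?) ((λ { (_ ∷ a) → a }) , (py ∷_)) W))
  drop : ∀ {y} → ¬ P y → filter (all? P?) (map (y ∷_) W) ≡ []
  drop {y} ¬py = trans (filter-map (all? P?) (y ∷_) W)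
                       (cong (map (y ∷_)) (filter-none (all? P? ∘ (y ∷_)) {W}
                                                       (All.tabulate (λ _ → λ { (py ∷ _) → ¬py py }))))
  go : ∀ ys → filter (all? P?) (concatMap (λ x → map (x ∷_) W) ys) ≡
              concatMap (λ x → map (x ∷_) (filter (all? P?) W)) (filter P? ys)
  go []       = refl
  go (y ∷ ys) with P? y
  ... | yes py = trans (filter-++ (all? P?) (map (y ∷_) W) _) (cong₂ _++_ (keep py) (go ys))
  ... | no ¬py = trans (filter-++ (all? P?) (map (y ∷_) W) _) (cong₂ _++_ (drop ¬py) (go ys))

-- Relabelling letters by the order embedding ℕ → ℕ ∖ {j}

punchIn : ℕ → ℕ → ℕ
punchIn zero    t       = suc t
punchIn (suc j) zero    = zero
punchIn (suc j) (suc t) = suc (punchIn j t)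

punchIn-injective : ∀ j {a b} → punchIn j a ≡ punchIn j b → a ≡ b
punchIn-injective zero                    eq = ℕₚ.suc-injective eq
punchIn-injective (suc j) {zero}  {zero}  _  = refl
punchIn-injective (suc j) {zero}  {suc b} ()
punchIn-injective (suc j) {suc a} {zero}  ()
punchIn-injective (suc j) {suc a} {suc b} eq = cong suc (punchIn-injective j (ℕₚ.suc-injective eq))

s≤s-⇔ : ∀ {a b c d} → a ≤ b ⇔ c ≤ d → suc a ≤ suc b ⇔ suc c ≤ suc d
s≤s-⇔ a≤b⇔c≤d = mk⇔ (s≤s ∘ to a≤b⇔c≤d ∘ s≤s⁻¹) (s≤s ∘ from a≤b⇔c≤d ∘ s≤s⁻¹)

punchIn-<-⇔ : ∀ j {a b} → punchIn j a < punchIn j b ⇔ a < b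
punchIn-<-⇔ zero                    = mk⇔ s≤s⁻¹ s≤s
punchIn-<-⇔ (suc j) {zero}  {zero}  = mk⇔ (λ ()) (λ ())
punchIn-<-⇔ (suc j) {zero}  {suc b} = mk⇔ (λ _ → s≤s z≤n) (λ _ → s≤s z≤n)
punchIn-<-⇔ (suc j) {suc a} {zero}  = mk⇔ (λ ()) (λ ())
punchIn-<-⇔ (suc j) {suc a} {suc b} = s≤s-⇔ (punchIn-<-⇔ j)

punchIn-<-pivot-⇔ : ∀ j {t} → punchIn j t < j ⇔ t < j
punchIn-<-pivot-⇔ zero            = mk⇔ (λ ()) (λ ())
punchIn-<-pivot-⇔ (suc j) {zero}  = mk⇔ (λ _ → s≤s z≤n) (λ _ → s≤s z≤n)
punchIn-<-pivot-⇔ (suc j) {suc t} = s≤s-⇔ (punchIn-<-pivot-⇔ j)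

pivot-<-punchIn-⇔ : ∀ j {t} → j < punchIn j t ⇔ j ≤ t
pivot-<-punchIn-⇔ zero            = mk⇔ (λ _ → z≤n) (λ _ → s≤s z≤n)
pivot-<-punchIn-⇔ (suc j) {zero}  = mk⇔ (λ ()) (λ ())
pivot-<-punchIn-⇔ (suc j) {suc t} = s≤s-⇔ (pivot-<-punchIn-⇔ j)

filter-≢-applyUpTo : ∀ (g : ℕ → ℕ) → (∀ {a b} → g a ≡ g b → a ≡ b) → ∀ {i m} → i ≤ m →
  filter (λ x → ¬? (g i ≟ x)) (applyUpTo g (suc m)) ≡ applyUpTo (g ∘ punchIn i) m
filter-≢-applyUpTo g g-inj {zero} {m} _ =
  trans (filter-reject (λ x → ¬? (g 0 ≟ x)) (λ g0≢g0 → g0≢g0 refl))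
        (filter-all (λ x → ¬? (g 0 ≟ x)) (applyUpTo⁺₂ (g ∘ suc) m (λ _ → ℕₚ.0≢1+n ∘ g-inj)))
filter-≢-applyUpTo g g-inj {suc i} {suc m} (s≤s i≤m) =
  trans (filter-accept (λ x → ¬? (g (suc i) ≟ x)) (ℕₚ.0≢1+n ∘ sym ∘ g-inj))
        (cong (g 0 ∷_) (filter-≢-applyUpTo (g ∘ suc) (ℕₚ.suc-injective ∘ g-inj) i≤m))

module _ {f : ℕ → ℕ} (f-<-⇔ : ∀ {a b} → f a < f b ⇔ a < b) where

  Down-map : ∀ {a b} → (∀ {t} → f t < a ⇔ t < b) → ∀ w → Down (a ∷ map f w) ⇔ Down (b ∷ w)
  Up-map   : ∀ {a b} → (∀ {t} → a < f t ⇔ b < t) → ∀ w → Up (a ∷ map f w) ⇔ Up (b ∷ w)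
  Down-map _   []      = ⇔-refl
  Down-map f<a (t ∷ w) = f<a ×-⇔ Up-map f-<-⇔ w
  Up-map   _   []      = ⇔-refl
  Up-map   a<f (t ∷ w) = a<f ×-⇔ Down-map f-<-⇔ w

Down-punchIn : ∀ i w → Down (suc i ∷ map (punchIn (suc i)) w) ⇔ Down (suc i ∷ w)
Down-punchIn i = Down-map (punchIn-<-⇔ (suc i)) (punchIn-<-pivot-⇔ (suc i))

Up-punchIn : ∀ i w → Up (suc i ∷ map (punchIn (suc i)) w) ⇔ Up (i ∷ w)
Up-punchIn i = Up-map (punchIn-<-⇔ (suc i)) (pivot-<-punchIn-⇔ (suc i))

-- Counting down-up permutations by their first letter

module Counting where

  open import Data.Nat using (_+_)
  open Sum ℕₚ.+-0-commutativeMonoid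
  open ≡-Reasoning

  count : ∀ {R : List ℕ → Set} → Decidable R → ℕ → ℕ
  count R? m = length (filter (λ w → unique? w ×-dec R? w) (words (applyUpTo suc m) m))

  count-cong : ∀ {R S : List ℕ → Set} (R? : Decidable R) (S? : Decidable S) m →
               (∀ {w} → R w ⇔ S w) → count R? m ≡ count S? m
  count-cong R? S? m R⇔S =
    cong length (filter-≐ (λ w → unique? w ×-dec R? w) (λ w → unique? w ×-dec S? w)
                          ((λ (u , r) → u , to R⇔S r) , (λ (u , s) → u , from R⇔S s))
                          (words (applyUpTo suc m) m))

  count-empty : ∀ {R : List ℕ → Set} (R? : Decidable R) m → (∀ {w} → ¬ R w) → count R? m ≡ 0
  count-empty R? m ¬R =
    cong length (filter-none (λ w → unique? w ×-dec R? w) {words (applyUpTo suc m) m}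
                             (All.tabulate (λ _ (_ , r) → ¬R r)))

  count-with-head : ∀ {R : List ℕ → Set} (R? : Decidable R) {i m} → i ≤ m →
    length (filter (λ w → unique? (suc i ∷ w) ×-dec R? (suc i ∷ w)) (words (applyUpTo suc (suc m)) m)) ≡
    count (λ w → R? (suc i ∷ map (punchIn (suc i)) w)) m
  count-with-head {R} R? {i} {m} i≤m = begin
    length (filter (λ w → unique? (z ∷ w) ×-dec R? (z ∷ w)) (words letters′ m))
      ≡⟨ cong length (filter-≐ (λ w → unique? (z ∷ w) ×-dec R? (z ∷ w)) (λ w → fresh? w ×-dec UR? w)
                               ((λ { (a ∷ u , r) → a , u , r }) , (λ (a , u , r) → a ∷ u , r))
                               (words letters′ m)) ⟩
    length (filter (λ w → fresh? w ×-dec UR? w) (words letters′ m))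
      ≡⟨ cong length (filter-×-dec fresh? UR? (words letters′ m)) ⟩
    length (filter UR? (filter fresh? (words letters′ m)))
      ≡⟨ cong (length ∘ filter UR?) (filter-all?-words (λ x → ¬? (z ≟ x)) letters′ m) ⟩
    length (filter UR? (words (filter (λ x → ¬? (z ≟ x)) letters′) m))
      ≡⟨ cong (λ xs → length (filter UR? (words xs m))) remove-z ⟩
    length (filter UR? (words (map (punchIn z) letters) m))
      ≡⟨ cong (length ∘ filter UR?) (words-map (punchIn z) letters m) ⟩
    length (filter UR? (map (map (punchIn z)) (words letters m)))
      ≡⟨ length-filter-map UR? (map (punchIn z)) (words letters m) ⟩
    length (filter (UR? ∘ map (punchIn z)) (words letters m))
      ≡⟨ cong length (filter-≐ (UR? ∘ map (punchIn z)) (λ w → unique? w ×-dec R? (z ∷ map (punchIn z) w))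
                               ((λ (u , r) → Unique.map⁻ u , r) ,
                                (λ (u , r) → Unique.map⁺ (punchIn-injective z) u , r))
                               (words letters m)) ⟩
    count (λ w → R? (z ∷ map (punchIn z) w)) m ∎
    where
    z = suc i
    letters = applyUpTo suc m
    letters′ = applyUpTo suc (suc m)
    fresh? = all? (λ x → ¬? (z ≟ x))
    UR? : Decidable (λ w → _ × R (z ∷ w))
    UR? w = unique? w ×-dec R? (z ∷ w)
    remove-z : filter (λ x → ¬? (z ≟ x)) letters′ ≡ map (punchIn z) letters
    remove-z = trans (filter-≢-applyUpTo suc ℕₚ.suc-injective i≤m)
                     (sym (map-applyUpTo suc (punchIn z) m))

  count-by-head : ∀ {R : List ℕ → Set} (R? : Decidable R) m →
    count R? (suc m) ≡ ∑ (suc m) (λ i → count (λ w → R? (suc i ∷ map (punchIn (suc i)) w)) m)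
  count-by-head R? m = begin
    count R? (suc m)
      ≡⟨ length-filter-words-suc UR? letters′ m ⟩
    foldr ℕ._+_ 0 (map (λ x → length (filter (UR? ∘ (x ∷_)) (words letters′ m))) letters′)
      ≡⟨ foldr-map-applyUpTo _ suc (suc m) ⟩
    ∑ (suc m) (λ i → length (filter (UR? ∘ (suc i ∷_)) (words letters′ m)))
      ≡⟨ ∑-cong (suc m) (count-with-head R? ∘ s≤s⁻¹) ⟩
    ∑ (suc m) (λ i → count (λ w → R? (suc i ∷ map (punchIn (suc i)) w)) m) ∎
    where
    letters′ = applyUpTo suc (suc m)
    UR? = λ w → unique? w ×-dec R? w

  -- countDown m y (resp. countUp m y) counts the permutations w of {1,…,m} with
  -- y > w₁ < w₂ > ⋯ (resp. y < w₁ > w₂ < ⋯); y need not be a letter of w.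
  countDown countUp : ℕ → ℕ → ℕ
  countDown m y = count (λ w → down? (y ∷ w)) m
  countUp   m y = count (λ w → up? (y ∷ w)) m

  downUpCount-suc : ∀ m → downUpCount (suc m) ≡ ∑ (suc m) (λ i → countDown m (suc i))
  downUpCount-suc m = trans (count-by-head down? m) (∑-cong (suc m) (λ {i} _ → relabel i))
    where
    relabel : ∀ i → count (λ w → down? (suc i ∷ map (punchIn (suc i)) w)) m ≡ countDown m (suc i)
    relabel i = count-cong (λ w → down? (suc i ∷ map (punchIn (suc i)) w)) (λ w → down? (suc i ∷ w)) m
                           (Down-punchIn i _)

  countDown-suc : ∀ {m y} → y ≤ suc m → countDown (suc m) (suc y) ≡ ∑ y (countUp m)
  countDown-suc {m} {y} y≤1+m = begin
    countDown (suc m) (suc y)  ≡⟨ count-by-head _ m ⟩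
    ∑ (suc m) byHead           ≡⟨ ∑-prefix byHead y≤1+m vanish ⟩
    ∑ y byHead                 ≡⟨ ∑-cong y relabel ⟩
    ∑ y (countUp m)            ∎
    where
    byHead : ℕ → ℕ
    byHead i = count (λ w → down? (suc y ∷ suc i ∷ map (punchIn (suc i)) w)) m
    vanish : ∀ {i} → y ≤ i → byHead i ≡ 0
    vanish y≤i = count-empty _ m (λ (i<y , _) → ℕₚ.<⇒≱ (s≤s⁻¹ i<y) y≤i)
    relabel : ∀ {i} → i < y → byHead i ≡ countUp m i
    relabel {i} i<y = count-cong _ _ m (mk⇔ (to (Up-punchIn i _) ∘ proj₂)
                                            ((s≤s i<y ,_) ∘ from (Up-punchIn i _)))

  countUp-suc : ∀ {m y} → y ≤ suc m → countUp (suc m) y ≡ ∑ (suc m ∸ y) (λ t → countDown m (suc (y + t)))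
  countUp-suc {m} {y} y≤1+m = begin
    countUp (suc m) y                                ≡⟨ count-by-head _ m ⟩
    ∑ (suc m) byHead                                 ≡⟨ ∑-suffix byHead y≤1+m vanish ⟩
    ∑ (suc m ∸ y) (λ t → byHead (y + t))             ≡⟨ ∑-cong (suc m ∸ y) (λ {t} _ → relabel t) ⟩
    ∑ (suc m ∸ y) (λ t → countDown m (suc (y + t)))  ∎
    where
    byHead : ℕ → ℕ
    byHead i = count (λ w → up? (y ∷ suc i ∷ map (punchIn (suc i)) w)) m
    vanish : ∀ {i} → i < y → byHead i ≡ 0
    vanish i<y = count-empty _ m (λ (y≤i , _) → ℕₚ.<⇒≱ i<y (s≤s⁻¹ y≤i))
    relabel : ∀ t → byHead (y + t) ≡ countDown m (suc (y + t))
    relabel t = count-cong _ _ m (mk⇔ (to (Down-punchIn (y + t) _) ∘ proj₂)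
                                      ((s≤s (ℕₚ.m≤m+n y t) ,_) ∘ from (Down-punchIn (y + t) _)))

  countUp≡countDown : ∀ {m k} → k ≤ m → countUp m k ≡ countDown m (suc (m ∸ k))
  countUp≡countDown {zero}  {zero} _ = refl
  countUp≡countDown {suc m} {k} k≤1+m = begin
    countUp (suc m) k                                 ≡⟨ countUp-suc k≤1+m ⟩
    ∑ N (λ t → countDown m (suc (k + t)))             ≡⟨ ∑-reverse N (λ t → countDown m (suc (k + t))) ⟩
    ∑ N (λ t → countDown m (suc (k + (N ∸ suc t))))   ≡⟨ ∑-cong N (cong (countDown m ∘ suc) ∘ reflect) ⟩
    ∑ N (λ t → countDown m (suc (m ∸ t)))             ≡⟨ ∑-cong N (λ t<N → sym (countUp≡countDown (t≤m t<N))) ⟩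
    ∑ N (countUp m)                                   ≡⟨ countDown-suc (ℕₚ.m∸n≤m (suc m) k) ⟨
    countDown (suc m) (suc N)                         ∎
    where
    N = suc m ∸ k
    t≤m : ∀ {t} → t < N → t ≤ m
    t≤m t<N = s≤s⁻¹ (ℕₚ.≤-trans t<N (ℕₚ.m∸n≤m (suc m) k))
    reflect : ∀ {t} → t < N → k + (N ∸ suc t) ≡ m ∸ t
    reflect {t} t<N = trans (sym (ℕₚ.+-∸-assoc k t<N)) (cong (_∸ suc t) (ℕₚ.m+[n∸m]≡n k≤1+m))

  E≡countDown : ∀ {n k} → k ≤ n → E n k ≡ countDown n (suc k)
  E≡countDown {zero}  {zero}  _         = refl
  E≡countDown {suc n} {zero}  _         = sym (countDown-suc {n} z≤n)
  E≡countDown {suc n} {suc k} (s≤s k≤n) = begin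
    E (suc n) k + E n (n ∸ k)
      ≡⟨ cong₂ _+_ (E≡countDown {suc n} {k} (ℕₚ.m≤n⇒m≤1+n k≤n)) (E≡countDown {n} (ℕₚ.m∸n≤m n k)) ⟩
    countDown (suc n) (suc k) + countDown n (suc (n ∸ k))
      ≡⟨ cong₂ _+_ (countDown-suc (ℕₚ.m≤n⇒m≤1+n k≤n)) (sym (countUp≡countDown k≤n)) ⟩
    ∑ k (countUp n) + countUp n k                 ≡⟨ ∑-init-last k (countUp n) ⟨
    ∑ (suc k) (countUp n)                         ≡⟨ countDown-suc (s≤s k≤n) ⟨
    countDown (suc n) (suc (suc k))               ∎

  downUpCount≡E : ∀ m → downUpCount m ≡ E m m
  downUpCount≡E zero    = refl
  downUpCount≡E (suc m) = begin
    downUpCount (suc m)                           ≡⟨ downUpCount-suc m ⟩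
    ∑ (suc m) (λ i → countDown m (suc i))         ≡⟨ ∑-reverse (suc m) (countDown m ∘ suc) ⟩
    ∑ (suc m) (λ t → countDown m (suc (m ∸ t)))   ≡⟨ ∑-cong (suc m) (λ t<1+m → sym (countUp≡countDown (s≤s⁻¹ t<1+m))) ⟩
    ∑ (suc m) (countUp m)                         ≡⟨ countDown-suc {m} ℕₚ.≤-refl ⟨
    countDown (suc m) (suc (suc m))               ≡⟨ E≡countDown {suc m} ℕₚ.≤-refl ⟨
    E (suc m) (suc m)                             ∎

-- The alternating binomial sums

module Alternating where

  open Sum ℤₚ.+-0-commutativeMonoid
  open import Algebra.Properties.AbelianGroup ℤₚ.+-0-abelianGroup using (∙-cancelʳ)
  open import Data.Integer using (_+_; _*_)
  open ≡-Reasoning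

  -- altTerm n k r unfolds to term ((- 1ℤ) ℤ.^ r) k (2r+1) n.
  term : ℤ → ℕ → ℕ → ℕ → ℤ
  term s k j n = s * + ((k C j) ℕ.* downUpCount (n ∸ j))

  evenTerm : ℕ → ℕ → ℕ → ℤ
  evenTerm n k r = term ((- 1ℤ) ℤ.^ r) k (2 ℕ.* r) n

  -- Both sums run over more indices than needed: the extra terms have C(k,j) = 0 for j > k.
  oddSum evenSum : ℕ → ℕ → ℤ
  oddSum  n k = ∑ k (altTerm n k)
  evenSum n k = ∑ (suc k) (evenTerm n k)

  term-pascal : ∀ s k j n → term s (suc k) (suc j) (suc n) ≡ term s k j n + term s k (suc j) (suc n)
  term-pascal s k j n = begin
    s * + ((suc k C suc j) ℕ.* d)
      ≡⟨ cong (λ c → s * + (c ℕ.* d)) (nCk+nC[k+1]≡[n+1]C[k+1] k j) ⟨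
    s * + ((k C j ℕ.+ k C suc j) ℕ.* d)
      ≡⟨ cong (λ x → s * + x) (ℕₚ.*-distribʳ-+ d (k C j) (k C suc j)) ⟩
    s * + ((k C j) ℕ.* d ℕ.+ (k C suc j) ℕ.* d)
      ≡⟨ cong (s *_) (ℤₚ.pos-+ ((k C j) ℕ.* d) ((k C suc j) ℕ.* d)) ⟩
    s * (+ ((k C j) ℕ.* d) + + ((k C suc j) ℕ.* d))
      ≡⟨ ℤₚ.*-distribˡ-+ s _ _ ⟩
    term s k j n + term s k (suc j) (suc n) ∎
    where d = downUpCount (n ∸ j)

  term-vanishes : ∀ s {k j} n → k < j → term s k j n ≡ 0ℤ
  term-vanishes s n k<j = trans (cong (λ c → s * + (c ℕ.* _)) (k>n⇒nCk≡0 k<j)) (ℤₚ.*-zeroʳ s)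

  term-neg-cancel : ∀ s k j n → term (- 1ℤ * s) k j n + term s k j n ≡ 0ℤ
  term-neg-cancel s k j n = begin
    (- 1ℤ * s) * x + s * x   ≡⟨ cong (_+ s * x) (ℤₚ.*-assoc (- 1ℤ) s x) ⟩
    - 1ℤ * (s * x) + s * x   ≡⟨ cong (_+ s * x) (ℤₚ.-1*i≡-i (s * x)) ⟩
    - (s * x) + s * x        ≡⟨ ℤₚ.+-inverseˡ (s * x) ⟩
    0ℤ                       ∎
    where x = + ((k C j) ℕ.* downUpCount (n ∸ j))

  altTerm-pascal : ∀ n k r → altTerm (suc n) (suc k) r ≡ evenTerm n k r + altTerm (suc n) k r
  altTerm-pascal n k r = begin
    term s (suc k) (2 ℕ.* r ℕ.+ 1) (suc n)             ≡⟨ cong (λ j → term s (suc k) j (suc n)) odd ⟩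
    term s (suc k) (suc (2 ℕ.* r)) (suc n)             ≡⟨ term-pascal s k (2 ℕ.* r) n ⟩
    evenTerm n k r + term s k (suc (2 ℕ.* r)) (suc n)  ≡⟨ cong (λ j → evenTerm n k r + term s k j (suc n)) odd ⟨
    evenTerm n k r + altTerm (suc n) k r               ∎
    where
    s = (- 1ℤ) ℤ.^ r
    odd = ℕₚ.+-comm (2 ℕ.* r) 1

  evenTerm-pascal : ∀ m k r → evenTerm (suc m) (suc k) (suc r) + altTerm m k r ≡ evenTerm (suc m) k (suc r)
  evenTerm-pascal m k r = begin
    term s′ (suc k) (2 ℕ.* suc r) (suc m) + t
      ≡⟨ cong (λ i → term s′ (suc k) i (suc m) + t) even ⟩
    term s′ (suc k) (suc j) (suc m) + t
      ≡⟨ cong (_+ t) (term-pascal s′ k j m) ⟩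
    (term s′ k j m + t′) + t
      ≡⟨ cong (_+ t) (ℤₚ.+-comm (term s′ k j m) t′) ⟩
    (t′ + term s′ k j m) + t
      ≡⟨ ℤₚ.+-assoc t′ (term s′ k j m) t ⟩
    t′ + (term s′ k j m + t)
      ≡⟨ cong (λ x → t′ + x) (term-neg-cancel s k j m) ⟩
    t′ + 0ℤ
      ≡⟨ ℤₚ.+-identityʳ t′ ⟩
    t′
      ≡⟨ cong (λ i → term s′ k i (suc m)) even ⟨
    evenTerm (suc m) k (suc r) ∎
    where
    s = (- 1ℤ) ℤ.^ r
    s′ = - 1ℤ * s
    j = 2 ℕ.* r ℕ.+ 1
    t = term s k j m
    t′ = term s′ k (suc j) (suc m)
    even : 2 ℕ.* suc r ≡ suc j
    even = trans (ℕₚ.*-suc 2 r) (cong suc (ℕₚ.+-comm 1 (2 ℕ.* r)))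

  altTerm-vanishes : ∀ n k r → k < 2 ℕ.* r ℕ.+ 1 → altTerm n k r ≡ 0ℤ
  altTerm-vanishes n k r = term-vanishes ((- 1ℤ) ℤ.^ r) {k} {2 ℕ.* r ℕ.+ 1} n

  evenTerm-vanishes : ∀ n k r → k < 2 ℕ.* r → evenTerm n k r ≡ 0ℤ
  evenTerm-vanishes n k r = term-vanishes ((- 1ℤ) ℤ.^ r) {k} {2 ℕ.* r} n

  altTerm-last : ∀ n k → altTerm n k k ≡ 0ℤ
  altTerm-last n k =
    altTerm-vanishes n k k (ℕₚ.≤-<-trans (ℕₚ.m≤m+n k (k ℕ.+ 0)) (ℕₚ.m<m+n _ (s≤s z≤n)))

  oddSum-pascal : ∀ n k → oddSum (suc n) (suc k) ≡ oddSum (suc n) k + evenSum n k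
  oddSum-pascal n k = begin
    ∑ (suc k) (altTerm (suc n) (suc k))
      ≡⟨ ∑-cong (suc k) (λ {r} _ → altTerm-pascal n k r) ⟩
    ∑ (suc k) (λ r → evenTerm n k r + altTerm (suc n) k r)
      ≡⟨ ∑-distrib (suc k) (evenTerm n k) (altTerm (suc n) k) ⟩
    evenSum n k + ∑ (suc k) (altTerm (suc n) k)
      ≡⟨ cong (λ x → evenSum n k + x) (∑-drop-last k (altTerm (suc n) k) (altTerm-last (suc n) k)) ⟩
    evenSum n k + oddSum (suc n) k
      ≡⟨ ℤₚ.+-comm (evenSum n k) (oddSum (suc n) k) ⟩
    oddSum (suc n) k + evenSum n k ∎

  evenSum-pascal : ∀ m k → evenSum (suc m) (suc k) + oddSum m k ≡ evenSum (suc m) k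
  evenSum-pascal m k = begin
    (e₀ + X) + oddSum m k
      ≡⟨ ℤₚ.+-assoc e₀ X (oddSum m k) ⟩
    e₀ + (X + oddSum m k)
      ≡⟨ cong (λ Y → e₀ + (X + Y)) (∑-drop-last k (altTerm m k) (altTerm-last m k)) ⟨
    e₀ + (X + ∑ (suc k) (altTerm m k))
      ≡⟨ cong (λ x → e₀ + x) (∑-distrib (suc k) (evenTerm (suc m) (suc k) ∘ suc) (altTerm m k)) ⟨
    e₀ + ∑ (suc k) (λ r → evenTerm (suc m) (suc k) (suc r) + altTerm m k r)
      ≡⟨ cong (λ x → e₀ + x) (∑-cong (suc k) (λ {r} _ → evenTerm-pascal m k r)) ⟩
    ∑ (suc (suc k)) (evenTerm (suc m) k)
      ≡⟨ ∑-drop-last (suc k) (evenTerm (suc m) k) (evenTerm-vanishes (suc m) k (suc k) (s≤s (ℕₚ.m≤m+n k _))) ⟩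
    evenSum (suc m) k ∎
    where
    e₀ = evenTerm (suc m) k 0
    X = ∑ (suc k) (evenTerm (suc m) (suc k) ∘ suc)

  E-suc-reflected : ∀ {m k} → k ≤ m → E (suc m) (suc m ∸ k) ≡ E (suc m) (m ∸ k) ℕ.+ E m k
  E-suc-reflected {m} {k} k≤m = begin
    E (suc m) (suc m ∸ k)                    ≡⟨ cong (E (suc m)) (ℕₚ.+-∸-assoc 1 k≤m) ⟩
    E (suc m) (m ∸ k) ℕ.+ E m (m ∸ (m ∸ k))  ≡⟨ cong (λ j → E (suc m) (m ∸ k) ℕ.+ E m j) (ℕₚ.m∸[m∸n]≡n k≤m) ⟩
    E (suc m) (m ∸ k) ℕ.+ E m k              ∎

  E≡oddSum            : ∀ {n k} → k < n → + E n k ≡ oddSum n k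
  E-reflected≡evenSum : ∀ {n k} → k < n → + E n (n ∸ k) ≡ evenSum n k

  E≡oddSum {suc n} {zero}  _         = refl
  E≡oddSum {suc n} {suc k} (s≤s k<n) = begin
    + (E (suc n) k ℕ.+ E n (n ∸ k))  ≡⟨ ℤₚ.pos-+ (E (suc n) k) (E n (n ∸ k)) ⟩
    + E (suc n) k + + E n (n ∸ k)    ≡⟨ cong₂ _+_ (E≡oddSum {suc n} {k} (ℕₚ.m≤n⇒m≤1+n k<n))
                                                  (E-reflected≡evenSum {n} k<n) ⟩
    oddSum (suc n) k + evenSum n k   ≡⟨ oddSum-pascal n k ⟨
    oddSum (suc n) (suc k)           ∎

  E-reflected≡evenSum {suc m} {zero} _ = begin
    + E (suc m) (suc m)           ≡⟨ cong +_ (Counting.downUpCount≡E (suc m)) ⟨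
    + downUpCount (suc m)         ≡⟨ cong +_ (ℕₚ.*-identityˡ (downUpCount (suc m))) ⟨
    + (1 ℕ.* downUpCount (suc m)) ≡⟨ ℤₚ.*-identityˡ _ ⟨
    evenTerm (suc m) 0 0          ≡⟨ ℤₚ.+-identityʳ _ ⟨
    evenSum (suc m) 0             ∎
  E-reflected≡evenSum {suc m} {suc k} (s≤s k<m) = ∙-cancelʳ (+ E m k) _ _ (begin
    + E (suc m) (m ∸ k) + + E m k         ≡⟨ ℤₚ.pos-+ (E (suc m) (m ∸ k)) (E m k) ⟨
    + (E (suc m) (m ∸ k) ℕ.+ E m k)       ≡⟨ cong +_ (E-suc-reflected (ℕₚ.<⇒≤ k<m)) ⟨
    + E (suc m) (suc m ∸ k)               ≡⟨ E-reflected≡evenSum {suc m} {k} (ℕₚ.m≤n⇒m≤1+n k<m) ⟩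
    evenSum (suc m) k                     ≡⟨ evenSum-pascal m k ⟨
    evenSum (suc m) (suc k) + oddSum m k  ≡⟨ cong (λ x → evenSum (suc m) (suc k) + x) (E≡oddSum k<m) ⟨
    evenSum (suc m) (suc k) + + E m k     ∎)

  altSum≡oddSum : ∀ n k → altSum n k ≡ oddSum n k
  altSum≡oddSum n k =
    trans (foldr-map-filter (λ r → 2 ℕ.* r ℕ.+ 1 ℕ.≤? k) (altTerm n k)
                            (λ {r} → altTerm-vanishes n k r ∘ ℕₚ.≰⇒>) (upTo k))
          (foldr-map-applyUpTo (altTerm n k) id k)

proposition3 : ∀ (n k : ℕ) → 1 ≤ n → k ≤ n ∸ 1 →
    (Path (0 , 0) (n , k) ↔ Fin (E n k)) × (+ E n k ≡ altSum n k)
proposition3 (suc n) k _ k≤n =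
  paths↔E (suc n) k (ℕₚ.m≤n⇒m≤1+n k≤n) ,
  trans (Alternating.E≡oddSum (s≤s k≤n)) (sym (Alternating.altSum≡oddSum (suc n) k))
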